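{- Let $G_2$ be the group of (anti-)Möbius transformations generated by $$a_1(z)=-\overline{z},\quad a_2(z)=-\overline{z}+6,\quad a_3(z)=\frac{\overline{z}}{\overline{z}-1},\quad a_4(z)=\frac{5\overline{z}-12}{2\overline{z}-5}.$$ Then $G_2$ is a congruence subgroup of $\mathrm{PGL}_2(\mathbb{Z})$.
   Context: $\mathrm{PGL}_2(\mathbb{Z})$ is identified with the group of maps of $\widehat{\mathbb{C}}$ of the form $z\mapsto\frac{az+b}{cz+d}$ with $ad-bc=1$ and $z\mapsto\frac{a\overline{z}+b}{c\overline{z}+d}$ with $ad-bc=-1$, $a,b,c,d\in\mathbb{Z}$; under this identification $a_1,\dots,a_4$ correspond to integer matrices of determinant $-1$. A congruence subgroup of $\mathrm{PGL}_2(\mathbb{Z})$ is a subgroup containing the principal congruence subgroup $\Gamma(n)$ (image of $\{g\in\mathrm{SL}_2(\mathbb{Z}):g\equiv I\pmod n\}$) for some $n\ge1$. -}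

module Defs where

open import Data.Nat using (ℕ)
open import Data.Integer using (ℤ; +_; -[1+_]; _+_; _*_; _-_; -_)
open import Data.Integer.Divisibility using (_∣_)
open import Data.Product using (_×_)
open import Relation.Binary.PropositionalEquality using (_≡_)

-- 2x2 integer matrices (a b ; c d), acting as z ↦ (az+b)/(cz+d)
-- (det 1) or z ↦ (a z̄ + b)/(c z̄ + d) (det -1).
record Mat : Set where
  constructor mat
  field
    a b c d : ℤ

open Mat public

det : Mat → ℤ
det (mat a b c d) = a * d - b * c

_·_ : Mat → Mat → Mat
mat a b c d · mat a' b' c' d' =
  mat (a * a' + b * c') (a * b' + b * d') (c * a' + d * c') (c * b' + d * d')

neg : Mat → Mat
neg (mat a b c d) = mat (- a) (- b) (- c) (- d)

I₂ : Mat
I₂ = mat (+ 1) (+ 0) (+ 0) (+ 1)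

-- inverse of a matrix of determinant ±1: det · adj
inv : Mat → Mat
inv m@(mat a b c d) = mat (det m * d) (det m * (- b)) (det m * (- c)) (det m * a)

A₁ : Mat
A₁ = mat (- (+ 1)) (+ 0) (+ 0) (+ 1)
A₂ : Mat
A₂ = mat (- (+ 1)) (+ 6) (+ 0) (+ 1)
A₃ : Mat
A₃ = mat (+ 1) (+ 0) (+ 1) (- (+ 1))
A₄ : Mat
A₄ = mat (+ 5) (- (+ 12)) (+ 2) (- (+ 5))

data Gen : Mat → Set where
  g₁ : Gen A₁
  g₂ : Gen A₂
  g₃ : Gen A₃
  g₄ : Gen A₄

-- Lifts to GL₂(ℤ) of the elements of G₂ = ⟨a1,a2,a3,a4⟩ ≤ PGL₂(ℤ).
-- Closure under negation accounts for the quotient by ±I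
-- (composition of (anti-)Möbius maps corresponds to matrix product
-- since the entries are real).
data InG₂ : Mat → Set where
  one    : InG₂ I₂
  mulGen : ∀ {g m} → Gen g → InG₂ m → InG₂ (g · m)
  mulInv : ∀ {g m} → Gen g → InG₂ m → InG₂ (inv g · m)
  negate : ∀ {m} → InG₂ m → InG₂ (neg m)

≡I-mod : ℕ → Mat → Set
≡I-mod n (mat a b c d) =
  (+ n ∣ a - + 1) × (+ n ∣ b) × (+ n ∣ c) × (+ n ∣ d - + 1)

ContainsΓ : ℕ → Set
ContainsΓ n = ∀ (g : Mat) → det g ≡ + 1 → ≡I-mod n g → InG₂ g

{-# OPTIONS --safe #-}
-- G₂ contains Γ⁰(6), the matrices of determinant ±1 with 6 ∣ b, and hence Γ(6).
-- For m ∈ Γ⁰(6) descend on ∣d∣.  Since b and d are coprime and 6 ∣ b, d ≠ 0, and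
-- after a sign change d = D > 0.  The translations z ↦ z + 6t (powers of a₂a₁)
-- reduce b = 6β modulo 6D to b = 6r with 0 ≤ r < D, and a₂ (b ↦ 6D − b) further
-- achieves 2r ≤ D.  If r = 0 then m is lower triangular with diagonal ±1, a power
-- of −a₃a₁ possibly times a₁.  Otherwise D ≠ 3r and D ≠ 2r (else 3 resp. 2 divides
-- det m), so either 3r < D and a₃ (d ↦ 6r − D) or 2r < D < 3r and a₄
-- (d ↦ 12r − 5D) strictly decreases ∣d∣.
module Submission where

open import Defs
open import Data.Nat using (ℕ; _≤_)
open import Data.Product using (Σ; _×_)

open import Data.Nat as ℕ using (zero; suc; _<_; z≤n; s≤s; _∸_)
import Data.Nat.Properties as ℕ
import Data.Nat.Divisibility as ℕ
open import Data.Nat.Induction using (<-wellFounded)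
open import Data.Integer using (ℤ; +_; +[1+_]; -[1+_]; _+_; _*_; _-_; -_; ∣_∣; _⊖_; 0ℤ; 1ℤ; -1ℤ)
import Data.Integer.Properties as ℤ
open import Data.Integer.Divisibility.Signed
  using (_∣_; divides; quotient; ∣ᵤ⇒∣; ∣⇒∣ᵤ; ∣m∣n⇒∣m+n; ∣m∣n⇒∣m-n; ∣m⇒∣-m; ∣n⇒∣m*n; ∣m⇒∣m*n)
open import Data.Integer.DivMod using (_%ℕ_; _/ℕ_; a≡a%ℕn+[a/ℕn]*n; n%ℕd<d)
open import Data.Integer.Tactic.RingSolver using (solve-∀)
open import Data.Product using (_,_)
open import Data.Empty using (⊥; ⊥-elim)
open import Data.Sum using (inj₁; inj₂)
open import Function using (_∘_)
open import Induction.WellFounded using (module All)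
import Relation.Binary.Construct.On as On
open import Relation.Binary.Definitions using (tri<; tri≈; tri>)
open import Relation.Binary.PropositionalEquality
open import Relation.Nullary using (yes; no)

mat-≡ : ∀ {a b c d a′ b′ c′ d′} → a ≡ a′ → b ≡ b′ → c ≡ c′ → d ≡ d′ →
        mat a b c d ≡ mat a′ b′ c′ d′
mat-≡ refl refl refl refl = refl

·-assoc : ∀ m n p → m · (n · p) ≡ (m · n) · p
·-assoc m n p = mat-≡ (entry (a m) (b m) (a p) (c p)) (entry (a m) (b m) (b p) (d p))
                      (entry (c m) (d m) (a p) (c p)) (entry (c m) (d m) (b p) (d p))
  where
    row-column : ∀ x y e f g h u v → x * (e * u + f * v) + y * (g * u + h * v)
                                   ≡ (x * e + y * g) * u + (x * f + y * h) * v
    row-column = solve-∀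
    entry : ∀ x y u v → x * (a n * u + b n * v) + y * (c n * u + d n * v)
                      ≡ (x * a n + y * c n) * u + (x * b n + y * d n) * v
    entry x y = row-column x y (a n) (b n) (c n) (d n)

·-identityˡ : ∀ m → I₂ · m ≡ m
·-identityˡ m = mat-≡ (first (a m) (c m)) (first (b m) (d m)) (second (a m) (c m)) (second (b m) (d m))
  where
    first : ∀ x y → + 1 * x + + 0 * y ≡ x
    first = solve-∀
    second : ∀ x y → + 0 * x + + 1 * y ≡ y
    second = solve-∀

·-identityʳ : ∀ m → m · I₂ ≡ m
·-identityʳ m = mat-≡ (first (a m) (b m)) (second (a m) (b m)) (first (c m) (d m)) (second (c m) (d m))
  where
    first : ∀ x y → x * + 1 + y * + 0 ≡ x
    first = solve-∀
    second : ∀ x y → x * + 0 + y * + 1 ≡ y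
    second = solve-∀

neg-·ˡ : ∀ m n → neg m · n ≡ neg (m · n)
neg-·ˡ m n = mat-≡ (entry (a m) (b m) (a n) (c n)) (entry (a m) (b m) (b n) (d n))
                   (entry (c m) (d m) (a n) (c n)) (entry (c m) (d m) (b n) (d n))
  where
    entry : ∀ x y u v → - x * u + - y * v ≡ - (x * u + y * v)
    entry = solve-∀

neg-involutive : ∀ m → neg (neg m) ≡ m
neg-involutive m = mat-≡ (ℤ.neg-involutive (a m)) (ℤ.neg-involutive (b m))
                         (ℤ.neg-involutive (c m)) (ℤ.neg-involutive (d m))

det-· : ∀ m n → det (m · n) ≡ det m * det n
det-· m n = cauchy-binet (a m) (b m) (c m) (d m) (a n) (b n) (c n) (d n)
  where
    cauchy-binet : ∀ p q r s e f g h →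
      (p * e + q * g) * (r * f + s * h) - (p * f + q * h) * (r * e + s * g)
      ≡ (p * s - q * r) * (e * h - f * g)
    cauchy-binet = solve-∀

det-neg : ∀ m → det (neg m) ≡ det m
det-neg m = entry (a m) (b m) (c m) (d m)
  where
    entry : ∀ p q r s → - p * - s - - q * - r ≡ p * s - q * r
    entry = solve-∀

∣b∣d⇒∣det : ∀ {k} m → k ∣ b m → k ∣ d m → k ∣ det m
∣b∣d⇒∣det m k∣b k∣d = ∣m∣n⇒∣m-n (∣n⇒∣m*n (a m) k∣d) (∣m⇒∣m*n (c m) k∣b)

unimodular⇒∣b∣d⇒∣k∣≡1 : ∀ {k} m → ∣ det m ∣ ≡ 1 → k ∣ b m → k ∣ d m → ∣ k ∣ ≡ 1
unimodular⇒∣b∣d⇒∣k∣≡1 m unit k∣b k∣d =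
  ℕ.∣1⇒≡1 (subst (ℕ._∣_ _) unit (∣⇒∣ᵤ (∣b∣d⇒∣det m k∣b k∣d)))

record Γ⁰ (n : ℕ) (m : Mat) : Set where
  field
    unimodular : ∣ det m ∣ ≡ 1
    n∣b        : + n ∣ b m
open Γ⁰

Γ⁰-· : ∀ {n m p} → Γ⁰ n m → Γ⁰ n p → Γ⁰ n (m · p)
Γ⁰-· {n} {m} {p} γ δ = record
  { unimodular = begin
      ∣ det (m · p) ∣            ≡⟨ cong ∣_∣ (det-· m p) ⟩
      ∣ det m * det p ∣          ≡⟨ ℤ.abs-* (det m) (det p) ⟩
      ∣ det m ∣ ℕ.* ∣ det p ∣    ≡⟨ cong₂ ℕ._*_ (unimodular γ) (unimodular δ) ⟩
      1                          ∎
  ; n∣b = ∣m∣n⇒∣m+n (∣n⇒∣m*n (a m) (n∣b δ)) (∣m⇒∣m*n (d p) (n∣b γ))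
  }
  where open ≡-Reasoning

Γ⁰-neg : ∀ {n m} → Γ⁰ n m → Γ⁰ n (neg m)
Γ⁰-neg {m = m} γ = record
  { unimodular = trans (cong ∣_∣ (det-neg m)) (unimodular γ)
  ; n∣b        = ∣m⇒∣-m (n∣b γ)
  }

Γ⊆Γ⁰ : ∀ {n} g → det g ≡ + 1 → ≡I-mod n g → Γ⁰ n g
Γ⊆Γ⁰ g det≡1 (_ , n∣b , _) = record { unimodular = cong ∣_∣ det≡1 ; n∣b = ∣ᵤ⇒∣ n∣b }

Multiplier : Mat → Set
Multiplier x = ∀ {m} → InG₂ m → InG₂ (x · m)

multiplier-· : ∀ {x y} → Multiplier x → Multiplier y → Multiplier (x · y)
multiplier-· {x} {y} mx my {m} h = subst InG₂ (·-assoc x y m) (mx (my h))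

multiplier-neg : ∀ {x} → Multiplier x → Multiplier (neg x)
multiplier-neg {x} mx {m} h = subst InG₂ (sym (neg-·ˡ x m)) (negate (mx h))

multiplier-cancel : ∀ {x y m} → Multiplier x → x · y ≡ I₂ → InG₂ (y · m) → InG₂ m
multiplier-cancel {x} {y} {m} mx xy≡I h =
  subst InG₂ (trans (·-assoc x y m) (trans (cong (_· m) xy≡I) (·-identityˡ m))) (mx h)

gen-involutive : ∀ {g} → Gen g → g · g ≡ I₂
gen-involutive g₁ = refl
gen-involutive g₂ = refl
gen-involutive g₃ = refl
gen-involutive g₄ = refl

gen-cancel : ∀ {g m} → Gen g → InG₂ (g · m) → InG₂ m
gen-cancel {g} gen = multiplier-cancel {g} {g} (mulGen gen) (gen-involutive gen)

homomorphism-multiplier : (M : ℤ → Mat) → M 0ℤ ≡ I₂ → (∀ i j → M (i + j) ≡ M i · M j) →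
                          Multiplier (M 1ℤ) → Multiplier (M -1ℤ) → ∀ t → Multiplier (M t)
homomorphism-multiplier M M0≡I M-+ m₊ m₋ = go
  where
    step : ∀ i j → Multiplier (M i) → Multiplier (M j) → Multiplier (M (i + j))
    step i j mi mj = subst Multiplier (sym (M-+ i j)) (multiplier-· {M i} {M j} mi mj)
    go : ∀ t → Multiplier (M t)
    go (+ zero)       {m} h = subst InG₂ (sym (trans (cong (_· m) M0≡I) (·-identityˡ m))) h
    go +[1+ n ]           = step 1ℤ (+ n) m₊ (go (+ n))
    go -[1+ zero ]        = m₋
    go -[1+ suc n ]       = step -1ℤ -[1+ n ] m₋ (go -[1+ n ])

-- T 1 = a₂a₁ and L 1 = −a₃a₁.
T : ℤ → Mat
T t = mat (+ 1) (+ 6 * t) (+ 0) (+ 1)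

L : ℤ → Mat
L s = mat (+ 1) (+ 0) s (+ 1)

T-+ : ∀ i j → T (i + j) ≡ T i · T j
T-+ i j = mat-≡ (a-entry i) (b-entry i j) refl (d-entry j)
  where
    a-entry : ∀ i → + 1 ≡ + 1 * + 1 + + 6 * i * + 0
    a-entry = solve-∀
    b-entry : ∀ i j → + 6 * (i + j) ≡ + 1 * (+ 6 * j) + + 6 * i * + 1
    b-entry = solve-∀
    d-entry : ∀ j → + 1 ≡ + 0 * (+ 6 * j) + + 1 * + 1
    d-entry = solve-∀

L-+ : ∀ i j → L (i + j) ≡ L i · L j
L-+ i j = mat-≡ (a-entry j) refl (c-entry i j) (d-entry i)
  where
    a-entry : ∀ j → + 1 ≡ + 1 * + 1 + + 0 * j
    a-entry = solve-∀
    c-entry : ∀ i j → i + j ≡ i * + 1 + + 1 * j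
    c-entry = solve-∀
    d-entry : ∀ i → + 1 ≡ i * + 0 + + 1 * + 1
    d-entry = solve-∀

T-multiplier : ∀ t → Multiplier (T t)
T-multiplier = homomorphism-multiplier T refl T-+
  (multiplier-· {A₂} {A₁} (mulGen g₂) (mulGen g₁))
  (multiplier-· {A₁} {A₂} (mulGen g₁) (mulGen g₂))

L-multiplier : ∀ s → Multiplier (L s)
L-multiplier = homomorphism-multiplier L refl L-+
  (multiplier-neg {A₃ · A₁} (multiplier-· {A₃} {A₁} (mulGen g₃) (mulGen g₁)))
  (multiplier-neg {A₁ · A₃} (multiplier-· {A₁} {A₃} (mulGen g₁) (mulGen g₃)))

T-inverseʳ : ∀ t → T t · T (- t) ≡ I₂
T-inverseʳ t = trans (sym (T-+ t (- t))) (cong T (ℤ.+-inverseʳ t))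

diagonal-lower∈G₂ : ∀ {x} s → ∣ x ∣ ≡ 1 → InG₂ (mat x (+ 0) s (+ 1))
diagonal-lower∈G₂ {+[1+ zero ]} s _ = subst InG₂ (·-identityʳ (L s)) (L-multiplier s one)
diagonal-lower∈G₂ { -[1+ zero ]} s _ =
  subst InG₂ (mat-≡ (a-entry s) refl (c-entry s) refl) (mulGen g₁ (diagonal-lower∈G₂ {+ 1} s refl))
  where
    a-entry : ∀ s → - (+ 1) * + 1 + + 0 * s ≡ - (+ 1)
    a-entry = solve-∀
    c-entry : ∀ s → + 0 * + 1 + + 1 * s ≡ s
    c-entry = solve-∀
diagonal-lower∈G₂ {+ zero}         _ ()
diagonal-lower∈G₂ {+[1+ suc _ ]}   _ ()
diagonal-lower∈G₂ { -[1+ suc _ ]} _ ()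

Γ⁰-gen : ∀ {g} → Gen g → Γ⁰ 6 g
Γ⁰-gen g₁ = record { unimodular = refl ; n∣b = divides (+ 0) refl }
Γ⁰-gen g₂ = record { unimodular = refl ; n∣b = divides (+ 1) refl }
Γ⁰-gen g₃ = record { unimodular = refl ; n∣b = divides (+ 0) refl }
Γ⁰-gen g₄ = record { unimodular = refl ; n∣b = divides (- + 2) refl }

Γ⁰-T : ∀ t → Γ⁰ 6 (T t)
Γ⁰-T t = record { unimodular = cong ∣_∣ (det-T t) ; n∣b = divides t (ℤ.*-comm (+ 6) t) }
  where
    det-T : ∀ t → + 1 * + 1 - + 6 * t * + 0 ≡ + 1
    det-T = solve-∀

∣m⊖n∣<o : ∀ {m n o} .{{_ : ℕ.NonZero o}} → m < n ℕ.+ o → n < m ℕ.+ o → ∣ m ⊖ n ∣ < o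
∣m⊖n∣<o {m} {n} {o} m<n+o n<m+o with m ℕ.≤? n
... | yes m≤n = subst (_< o) (sym (ℤ.∣⊖∣-≤ m≤n)) (ℕ.m<n+o⇒m∸n<o n m n<m+o)
... | no  m≰n = subst (_< o) (sym (trans (ℤ.∣m⊖n∣≡∣n⊖m∣ m n) (ℤ.∣⊖∣-≰ m≰n)))
                      (ℕ.m<n+o⇒m∸n<o m n m<n+o)

∣6r⊖D∣<D : ∀ {r D} .{{_ : ℕ.NonZero D}} → 0 < r → 3 ℕ.* r < D → ∣ 6 ℕ.* r ⊖ D ∣ < D
∣6r⊖D∣<D {r} {D} 0<r 3r<D = ∣m⊖n∣<o 6r<D+D (ℕ.m<n+m D (ℕ.*-monoʳ-< 6 0<r))
  where
    open ℕ.≤-Reasoning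
    6r<D+D : 6 ℕ.* r < D ℕ.+ D
    6r<D+D = begin-strict
      6 ℕ.* r             ≡⟨ ℕ.*-distribʳ-+ r 3 3 ⟩
      3 ℕ.* r ℕ.+ 3 ℕ.* r <⟨ ℕ.+-mono-< 3r<D 3r<D ⟩
      D ℕ.+ D             ∎

∣12r⊖5D∣<D : ∀ {r D} .{{_ : ℕ.NonZero D}} → D < 3 ℕ.* r → 2 ℕ.* r < D →
             ∣ 12 ℕ.* r ⊖ 5 ℕ.* D ∣ < D
∣12r⊖5D∣<D {r} {D} D<3r 2r<D = ∣m⊖n∣<o 12r<5D+D 5D<12r+D
  where
    open ℕ.≤-Reasoning
    12r<5D+D : 12 ℕ.* r < 5 ℕ.* D ℕ.+ D
    12r<5D+D = begin-strict
      12 ℕ.* r       ≡⟨ ℕ.*-assoc 6 2 r ⟩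
      6 ℕ.* (2 ℕ.* r) <⟨ ℕ.*-monoʳ-< 6 2r<D ⟩
      D ℕ.+ 5 ℕ.* D  ≡⟨ ℕ.+-comm D (5 ℕ.* D) ⟩
      5 ℕ.* D ℕ.+ D  ∎
    5D<12r+D : 5 ℕ.* D < 12 ℕ.* r ℕ.+ D
    5D<12r+D = begin-strict
      D ℕ.+ 4 ℕ.* D         ≡⟨ ℕ.+-comm D (4 ℕ.* D) ⟩
      4 ℕ.* D ℕ.+ D         <⟨ ℕ.+-monoˡ-< D (ℕ.*-monoʳ-< 4 D<3r) ⟩
      4 ℕ.* (3 ℕ.* r) ℕ.+ D ≡⟨ cong (ℕ._+ D) (ℕ.*-assoc 4 3 r) ⟨
      12 ℕ.* r ℕ.+ D        ∎

2[n∸m]≤n : ∀ {m n} → m ≤ n → n ≤ 2 ℕ.* m → 2 ℕ.* (n ∸ m) ≤ n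
2[n∸m]≤n {m} {n} m≤n n≤2m = begin
  2 ℕ.* (n ∸ m)         ≡⟨ cong ((n ∸ m) ℕ.+_) (ℕ.+-identityʳ (n ∸ m)) ⟩
  (n ∸ m) ℕ.+ (n ∸ m)   ≤⟨ ℕ.+-monoʳ-≤ (n ∸ m) (ℕ.m≤n+o⇒m∸n≤o n m n≤m+m) ⟩
  (n ∸ m) ℕ.+ m         ≡⟨ ℕ.m∸n+n≡m m≤n ⟩
  n                     ∎
  where
    open ℕ.≤-Reasoning
    n≤m+m : n ≤ m ℕ.+ m
    n≤m+m = subst (n ≤_) (cong (m ℕ.+_) (ℕ.+-identityʳ m)) n≤2m

d-A₃· : ∀ m → d (A₃ · m) ≡ b m - d m
d-A₃· m = entry (b m) (d m)
  where
    entry : ∀ x y → + 1 * x + - + 1 * y ≡ x - y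
    entry = solve-∀

d-A₄· : ∀ m → d (A₄ · m) ≡ + 2 * b m - + 5 * d m
d-A₄· m = entry (b m) (d m)
  where
    entry : ∀ x y → + 2 * x + - + 5 * y ≡ + 2 * x - + 5 * y
    entry = solve-∀

b-A₂· : ∀ m → b (A₂ · m) ≡ + 6 * d m - b m
b-A₂· m = entry (b m) (d m)
  where
    entry : ∀ x y → - + 1 * x + + 6 * y ≡ + 6 * y - x
    entry = solve-∀

d-[0,1]· : ∀ x y m → d (mat x y (+ 0) (+ 1) · m) ≡ d m
d-[0,1]· _ _ m = entry (b m) (d m)
  where
    entry : ∀ x y → + 0 * x + + 1 * y ≡ y
    entry = solve-∀

b-T· : ∀ t m → b (T t · m) ≡ b m + + 6 * t * d m
b-T· t m = entry (b m) (d m)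
  where
    entry : ∀ x y → + 1 * x + + 6 * t * y ≡ x + + 6 * t * y
    entry = solve-∀

Below : ℕ → Set
Below D = ∀ {m} → ∣ d m ∣ < D → Γ⁰ 6 m → InG₂ m

reduced-no-common-factor : ∀ {m r D} k → ∣ det m ∣ ≡ 1 → b m ≡ + (6 ℕ.* r) → d m ≡ + D →
                           1 < k → k ℕ.∣ 6 → k ℕ.* r ≡ D → ⊥
reduced-no-common-factor {m} {r} {D} k unit b≡6r d≡D 1<k k∣6 kr≡D =
  ℕ.<⇒≢ 1<k (sym (unimodular⇒∣b∣d⇒∣k∣≡1 {+ k} m unit (∣ᵤ⇒∣ k∣b) (∣ᵤ⇒∣ k∣d)))
  where
    k∣b : k ℕ.∣ ∣ b m ∣
    k∣b = subst (k ℕ.∣_) (sym (cong ∣_∣ b≡6r)) (ℕ.∣m⇒∣m*n r k∣6)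
    k∣d : k ℕ.∣ ∣ d m ∣
    k∣d = subst (k ℕ.∣_) (sym (cong ∣_∣ (trans d≡D (cong +_ (sym kr≡D))))) (ℕ.m∣m*n r)

descend-reduced : ∀ {m} r D .{{_ : ℕ.NonZero D}} → Γ⁰ 6 m → b m ≡ + (6 ℕ.* r) → d m ≡ + D →
                  2 ℕ.* r ≤ D → Below D → InG₂ m
descend-reduced {m} zero D γ b≡0 d≡D _ _ =
  subst InG₂ (mat-≡ refl (sym b≡0) refl (sym d≡1))
    (diagonal-lower∈G₂ (c m) (ℕ.m*n≡1⇒m≡1 ∣ a m ∣ D ∣a∣D≡1))
  where
    open ≡-Reasoning
    upper-zero : ∀ x y z → x * y - + 0 * z ≡ x * y
    upper-zero = solve-∀
    ∣a∣D≡1 : ∣ a m ∣ ℕ.* D ≡ 1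
    ∣a∣D≡1 = begin
      ∣ a m ∣ ℕ.* D                 ≡⟨ ℤ.abs-* (a m) (+ D) ⟨
      ∣ a m * + D ∣                 ≡⟨ cong ∣_∣ (upper-zero (a m) (+ D) (c m)) ⟨
      ∣ a m * + D - + 0 * c m ∣     ≡⟨ cong ∣_∣ (cong₂ (λ x y → a m * y - x * c m) b≡0 d≡D) ⟨
      ∣ det m ∣                     ≡⟨ unimodular γ ⟩
      1                             ∎
    d≡1 : d m ≡ + 1
    d≡1 = trans d≡D (cong +_ (ℕ.m*n≡1⇒n≡1 ∣ a m ∣ D ∣a∣D≡1))
descend-reduced {m} r@(suc _) D γ b≡6r d≡D 2r≤D below with ℕ.<-cmp (3 ℕ.* r) D
... | tri< 3r<D _ _ =
  gen-cancel g₃ (below ∣d∣<D (Γ⁰-· (Γ⁰-gen g₃) γ))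
  where
    ∣d∣<D : ∣ d (A₃ · m) ∣ < D
    ∣d∣<D = subst (_< D) (cong ∣_∣ (sym (begin
      d (A₃ · m)        ≡⟨ d-A₃· m ⟩
      b m - d m         ≡⟨ cong₂ _-_ b≡6r d≡D ⟩
      + (6 ℕ.* r) - + D ≡⟨ ℤ.[+m]-[+n]≡m⊖n (6 ℕ.* r) D ⟩
      6 ℕ.* r ⊖ D       ∎))) (∣6r⊖D∣<D {r} ℕ.z<s 3r<D)
      where open ≡-Reasoning
... | tri≈ _ 3r≡D _ = ⊥-elim (reduced-no-common-factor {m} {r} 3 (unimodular γ) b≡6r d≡D
                                                    (s≤s (s≤s z≤n)) (ℕ.divides 2 refl) 3r≡D)
... | tri> _ _ D<3r with ℕ.m≤n⇒m<n∨m≡n 2r≤D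
...   | inj₂ 2r≡D = ⊥-elim (reduced-no-common-factor {m} {r} 2 (unimodular γ) b≡6r d≡D
                                                    (s≤s (s≤s z≤n)) (ℕ.divides 3 refl) 2r≡D)
...   | inj₁ 2r<D =
  gen-cancel g₄ (below ∣d∣<D (Γ⁰-· (Γ⁰-gen g₄) γ))
  where
    ∣d∣<D : ∣ d (A₄ · m) ∣ < D
    ∣d∣<D = subst (_< D) (cong ∣_∣ (sym (begin
      d (A₄ · m)                      ≡⟨ d-A₄· m ⟩
      + 2 * b m - + 5 * d m           ≡⟨ cong₂ (λ x y → + 2 * x - + 5 * y) b≡6r d≡D ⟩
      + 2 * + (6 ℕ.* r) - + 5 * + D   ≡⟨ cong₂ _-_ (ℤ.pos-* 2 (6 ℕ.* r)) (ℤ.pos-* 5 D) ⟨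
      + (2 ℕ.* (6 ℕ.* r)) - + (5 ℕ.* D) ≡⟨ cong (λ x → + x - + (5 ℕ.* D)) (ℕ.*-assoc 2 6 r) ⟨
      + (12 ℕ.* r) - + (5 ℕ.* D)      ≡⟨ ℤ.[+m]-[+n]≡m⊖n (12 ℕ.* r) (5 ℕ.* D) ⟩
      12 ℕ.* r ⊖ 5 ℕ.* D              ∎))) (∣12r⊖5D∣<D {r} D<3r 2r<D)
      where open ≡-Reasoning

descend-normalised : ∀ {m} r D .{{_ : ℕ.NonZero D}} → r < D → Γ⁰ 6 m →
                     b m ≡ + (6 ℕ.* r) → d m ≡ + D →
                     Below D → InG₂ m
descend-normalised {m} r D r<D γ b≡6r d≡D below with 2 ℕ.* r ℕ.≤? D
... | yes 2r≤D = descend-reduced r D γ b≡6r d≡D 2r≤D below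
... | no  2r≰D = gen-cancel g₂
  (descend-reduced (D ∸ r) D (Γ⁰-· (Γ⁰-gen g₂) γ) b≡6[D∸r] (trans (d-[0,1]· (- + 1) (+ 6) m) d≡D)
                   (2[n∸m]≤n (ℕ.<⇒≤ r<D) (ℕ.<⇒≤ (ℕ.≰⇒> 2r≰D))) below)
  where
    open ≡-Reasoning
    b≡6[D∸r] : b (A₂ · m) ≡ + (6 ℕ.* (D ∸ r))
    b≡6[D∸r] = begin
      b (A₂ · m)                   ≡⟨ b-A₂· m ⟩
      + 6 * d m - b m              ≡⟨ cong₂ (λ x y → + 6 * x - y) d≡D b≡6r ⟩
      + 6 * + D - + (6 ℕ.* r)      ≡⟨ cong (_- + (6 ℕ.* r)) (ℤ.pos-* 6 D) ⟨
      + (6 ℕ.* D) - + (6 ℕ.* r)    ≡⟨ ℤ.[+m]-[+n]≡m⊖n (6 ℕ.* D) (6 ℕ.* r) ⟩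
      6 ℕ.* D ⊖ 6 ℕ.* r            ≡⟨ ℤ.⊖-≥ (ℕ.*-monoʳ-≤ 6 (ℕ.<⇒≤ r<D)) ⟩
      + (6 ℕ.* D ∸ 6 ℕ.* r)        ≡⟨ cong +_ (ℕ.*-distribˡ-∸ 6 D r) ⟨
      + (6 ℕ.* (D ∸ r))            ∎

descend-positive : ∀ {m} k → Γ⁰ 6 m → d m ≡ +[1+ k ] → Below (suc k) → InG₂ m
descend-positive {m} k γ d≡D below =
  multiplier-cancel {T q} {T (- q)} (T-multiplier q) (T-inverseʳ q)
    (descend-normalised r D (n%ℕd<d β D) (Γ⁰-· (Γ⁰-T (- q)) γ) b≡6r
                        (trans (d-[0,1]· (+ 1) (+ 6 * - q) m) d≡D) below)
  where
    open ≡-Reasoning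
    D = suc k
    β = quotient (n∣b γ)
    r = β %ℕ D
    q = β /ℕ D
    reduce : ∀ r q x → (r + q * x) * + 6 + + 6 * - q * x ≡ + 6 * r
    reduce = solve-∀
    b≡6r : b (T (- q) · m) ≡ + (6 ℕ.* r)
    b≡6r = begin
      b (T (- q) · m)                          ≡⟨ b-T· (- q) m ⟩
      b m + + 6 * - q * d m
        ≡⟨ cong₂ (λ x y → x + + 6 * - q * y) (_∣_.equality (n∣b γ)) d≡D ⟩
      β * + 6 + + 6 * - q * + D
        ≡⟨ cong (λ x → x * + 6 + + 6 * - q * + D) (a≡a%ℕn+[a/ℕn]*n β D) ⟩
      (+ r + q * + D) * + 6 + + 6 * - q * + D  ≡⟨ reduce (+ r) q (+ D) ⟩
      + 6 * + r                                ≡⟨ ℤ.pos-* 6 r ⟨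
      + (6 ℕ.* r)                              ∎

descend : ∀ m → Below ∣ d m ∣ → Γ⁰ 6 m → InG₂ m
descend m@(mat _ _ _ (+ zero)) _ γ
  with unimodular⇒∣b∣d⇒∣k∣≡1 {+ 6} m (unimodular γ) (n∣b γ) (divides (+ 0) refl)
... | ()
descend m@(mat _ _ _ +[1+ k ]) below γ = descend-positive k γ refl below
descend m@(mat _ _ _ -[1+ k ]) below γ =
  subst InG₂ (neg-involutive m) (negate (descend-positive k (Γ⁰-neg γ) refl below))

Γ⁰[6]⊆G₂ : ∀ m → Γ⁰ 6 m → InG₂ m
Γ⁰[6]⊆G₂ = All.wfRec (On.wellFounded (∣_∣ ∘ d) <-wellFounded) _ (λ m → Γ⁰ 6 m → InG₂ m) descend

lemma9p1 : Σ ℕ (λ n → (1 ≤ n) × ContainsΓ n)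
lemma9p1 = 6 , s≤s z≤n , λ g det≡1 g≡I → Γ⁰[6]⊆G₂ g (Γ⊆Γ⁰ g det≡1 g≡I)
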